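{- Let $(\mathcal{A},\lambda,L)$ and $(\mathcal{A}',\lambda',L)$ be $Pom_L$-bisimilar labelled asynchronous systems, where $\mathcal{A}=(S,s_0,E,I,\mathrm{Tran})$ and $\mathcal{A}'=(S',s'_0,E',I',\mathrm{Tran}')$. Then for every $a_1\in E$ with $s_0\cdot a_1\in S$ there exists $a'_1\in E'$ such that (i) $s'_0\cdot a'_1\in S'$, and (ii) the labelled asynchronous systems $(\mathcal{A}(s_0\cdot a_1),\lambda,L)$ and $(\mathcal{A}'(s'_0\cdot a'_1),\lambda',L)$ are $Pom_L$-bisimilar.
   Context: A state space $(S,E,I,\mathrm{Tran})$ consists of a set $S$ of states, a set $E$ of events with a symmetric irreflexive independence relation $I\subseteq E\times E$, and a transition relation $\mathrm{Tran}\subseteq S\times E\times S$, such that: (1) if $(s,a,s')\in\mathrm{Tran}$ and $(s,a,s'')\in\mathrm{Tran}$ then $s'=s''$; (2) if $(a,b)\in I$, $(s,a,s')\in\mathrm{Tran}$ and $(s',b,s'')\in\mathrm{Tran}$, then there is $s_1\in S$ with $(s,b,s_1)\in\mathrm{Tran}$ and $(s_1,a,s'')\in\mathrm{Tran}$. An asynchronous system $\mathcal{A}=(S,s_0,E,I,\mathrm{Tran})$ is a state space with a distinguished initial state $s_0\in S$ such that every $a\in E$ occurs in some transition $(s_1,a,s_2)\in\mathrm{Tran}$. For $s\in S$ and a word $w=e_1\cdots e_k$ over $E$, we write $s\cdot w\in S$ if there are states $s=t_0,t_1,\dots,t_k$ with $(t_{i-1},e_i,t_i)\in\mathrm{Tran}$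 for all $i$, and then $s\cdot w=t_k$ (unique by axiom (1)); $s\cdot(\text{empty word})=s$. A state $s$ is reachable if $s=s_0\cdot w$ for some word $w$. For a reachable $s$, $\mathcal{A}(s)=(S,s,E,I,\mathrm{Tran})$ is the same system with initial state $s$. A morphism $(\sigma,\eta):\mathcal{A}\to\mathcal{A}'$ consists of a total map $\sigma:S\to S'$ with $\sigma(s_0)=s'_0$ and a partial map $\eta:E\rightharpoonup E'$ such that for every $(s_1,e,s_2)\in\mathrm{Tran}$: if $\eta(e)$ is defined then $(\sigma(s_1),\eta(e),\sigma(s_2))\in\mathrm{Tran}'$, and if $\eta(e)$ is undefined then $\sigma(s_1)=\sigma(s_2)$; and for all $(e_1,e_2)\in I$ with $\eta(e_1),\eta(e_2)$ both defined, $(\eta(e_1),\eta(e_2))\in I'$. Such a morphism is open if: (a) $\eta$ is total; (b) for every $s\in S$ and every $(\sigma(s),e',u')\in\mathrm{Tran}'$ there is $(s,e,u)\in\mathrm{Tran}$ with $\eta(e)=e'$ and $\sigma(u)=u'$; (c) for every reachable $s\in S$, if $(s,e_1,u)\in\mathrm{Tran}$, $(u,e_2,v)\in\mathrm{Tran}$ and $(\eta(e_1),\eta(e_2))\in I'$, then $(e_1,e_2)\in I$. A labelled asynchronous system $(\mathcal{A},\lambda,L)$ is an asynchronous system with a set $L$ of labels and a map $\lambda:E\to L$. A $Pom_L$-open morphism $(\mathcal{A},\lambda,L)\to(\mathcal{A}',\lambda',L)$ is an open morphism $(\sigma,\eta):\mathcal{A}\to\mathcal{A}'$ preserving labels, i.e.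 $\lambda(e)=\lambda'(\eta(e))$ for all $e\in E$. Two labelled asynchronous systems (with the same label set $L$) are $Pom_L$-bisimilar if there is a labelled asynchronous system $(\mathcal{A}'',\lambda'',L)$ with $Pom_L$-open morphisms from it to each of them. -}

module Defs where

open import Data.Empty using (⊥)
open import Data.Product using (Σ; ∃; _×_; _,_)
open import Data.Maybe using (Maybe; just; nothing)
open import Data.List using (List; []; _∷_)
open import Relation.Binary.PropositionalEquality using (_≡_)

record StateSpace : Set₁ where
  field
    S    : Set
    E    : Set
    I    : E → E → Set
    Tran : S → E → S → Set
    I-sym     : ∀ {a b} → I a b → I b a
    I-irrefl  : ∀ {a} → I a a → ⊥
    det  : ∀ {s a s′ s″} → Tran s a s′ → Tran s a s″ → s′ ≡ s″
    diamond : ∀ {a b s s′ s″} → I a b → Tran s a s′ → Tran s′ b s″ →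
              Σ S λ s₁ → Tran s b s₁ × Tran s₁ a s″

record AsyncSystem : Set₁ where
  field
    space : StateSpace
  open StateSpace space public
  field
    s₀    : S
    occurs : ∀ (a : E) → Σ S λ s₁ → Σ S λ s₂ → Tran s₁ a s₂

-- Runs: Run A s w t  means  s · w ∈ S and s · w = t.
module _ (A : AsyncSystem) where
  open AsyncSystem A
  data Run : S → List E → S → Set where
    run-[] : ∀ {s} → Run s [] s
    run-∷  : ∀ {s e t w u} → Tran s e t → Run t w u → Run s (e ∷ w) u

  Reachable : S → Set
  Reachable s = Σ (List E) λ w → Run s₀ w s

restart : (A : AsyncSystem) → AsyncSystem.S A → AsyncSystem
restart A s = record
  { space  = AsyncSystem.space A
  ; s₀     = s
  ; occurs = AsyncSystem.occurs A
  }

record Morphism (A A′ : AsyncSystem) : Set where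
  module A = AsyncSystem A
  module A′ = AsyncSystem A′
  field
    σ : A.S → A′.S
    η : A.E → Maybe A′.E
    σ-init : σ A.s₀ ≡ A′.s₀
    tran-def   : ∀ {s₁ e s₂ e′} → A.Tran s₁ e s₂ → η e ≡ just e′ →
                 A′.Tran (σ s₁) e′ (σ s₂)
    tran-undef : ∀ {s₁ e s₂} → A.Tran s₁ e s₂ → η e ≡ nothing → σ s₁ ≡ σ s₂
    indep : ∀ {e₁ e₂ e₁′ e₂′} → A.I e₁ e₂ → η e₁ ≡ just e₁′ → η e₂ ≡ just e₂′ →
            A′.I e₁′ e₂′

record IsOpen {A A′ : AsyncSystem} (f : Morphism A A′) : Set where
  module SA = AsyncSystem A
  module SA′ = AsyncSystem A′
  open Morphism f
  field
    total : ∀ (e : SA.E) → Σ SA′.E λ e′ → η e ≡ just e′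
    lift  : ∀ (s : SA.S) {e′ u′} → SA′.Tran (σ s) e′ u′ →
            Σ SA.E λ e → Σ SA.S λ u → SA.Tran s e u × η e ≡ just e′ × σ u ≡ u′
    reflect : ∀ {s e₁ u e₂ v e₁′ e₂′} → Reachable A s →
              SA.Tran s e₁ u → SA.Tran u e₂ v →
              η e₁ ≡ just e₁′ → η e₂ ≡ just e₂′ → SA′.I e₁′ e₂′ → SA.I e₁ e₂

record LabelledAS (L : Set) : Set₁ where
  field
    sys : AsyncSystem
    λ-lab : AsyncSystem.E sys → L

restartL : ∀ {L} (X : LabelledAS L) → AsyncSystem.S (LabelledAS.sys X) → LabelledAS L
restartL X s = record { sys = restart (LabelledAS.sys X) s ; λ-lab = LabelledAS.λ-lab X }

record PomOpen {L : Set} (X Y : LabelledAS L) : Set where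
  field
    mor    : Morphism (LabelledAS.sys X) (LabelledAS.sys Y)
    isOpen : IsOpen mor
    labels : ∀ {e e′} → Morphism.η mor e ≡ just e′ →
             LabelledAS.λ-lab X e ≡ LabelledAS.λ-lab Y e′

PomBisimilar : {L : Set} → LabelledAS L → LabelledAS L → Set₁
PomBisimilar {L} X Y = Σ (LabelledAS L) λ Z → PomOpen Z X × PomOpen Z Y

-- The first move s₀ → t of X
-- lifts along Z → X to a move s₀ → u of Z with σ u = t, and its image under
-- Z → Y is a first move of Y. Restarting Z, X and Y at u, t and the image of u
-- keeps both morphisms Pom_L-open: only independence reflection mentions the
-- initial state, through reachability, and every state reachable from u is
-- reachable from s₀.
module Submission where

open import Defs
open import Data.Product using (Σ; _×_; _,_)
open import Data.List using (List; []; _∷_; _++_)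
open import Relation.Binary.PropositionalEquality using (_≡_; refl; sym; subst)

module _ (A : AsyncSystem) where
  open AsyncSystem A

  Run-++ : ∀ {s t u} {w w′ : List E} → Run A s w t → Run A t w′ u → Run A s (w ++ w′) u
  Run-++ run-[]       r′ = r′
  Run-++ (run-∷ x r)  r′ = run-∷ x (Run-++ r r′)

  Run-restart : ∀ {u s t} {w : List E} → Run (restart A u) s w t → Run A s w t
  Run-restart run-[]      = run-[]
  Run-restart (run-∷ x r) = run-∷ x (Run-restart r)

  Reachable-restart : ∀ {u s} → Reachable A u → Reachable (restart A u) s → Reachable A s
  Reachable-restart (w , r) (w′ , r′) = w ++ w′ , Run-++ r (Run-restart r′)

  Reachable-step : ∀ {e u} → Tran s₀ e u → Reachable A u
  Reachable-step {e} x = e ∷ [] , run-∷ x run-[]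

module _ {L : Set} {Z X : LabelledAS L} (f : PomOpen Z X) where
  open PomOpen f
  open Morphism mor
  open IsOpen isOpen
  private
    module Z = AsyncSystem (LabelledAS.sys Z)
    module X = AsyncSystem (LabelledAS.sys X)

  PomOpen-restart : ∀ {u t} → Reachable (LabelledAS.sys Z) u → σ u ≡ t →
                    PomOpen (restartL Z u) (restartL X t)
  PomOpen-restart reach σu≡t = record
    { mor = record
      { σ          = σ
      ; η          = η
      ; σ-init     = σu≡t
      ; tran-def   = tran-def
      ; tran-undef = tran-undef
      ; indep      = indep
      }
    ; isOpen = record
      { total   = total
      ; lift    = lift
      ; reflect = λ r → reflect (Reachable-restart (LabelledAS.sys Z) reach r)
      }
    ; labels = labels
    }

  lift-initial-step : ∀ {a t} → X.Tran X.s₀ a t →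
                      Σ Z.E λ e → Σ Z.S λ u → Z.Tran Z.s₀ e u × σ u ≡ t
  lift-initial-step {a} {t} x
    with lift Z.s₀ (subst (λ s → X.Tran s a t) (sym σ-init) x)
  ... | e , u , z , _ , σu≡t = e , u , z , σu≡t

  map-initial-step : ∀ {e u} → Z.Tran Z.s₀ e u →
                     Σ X.E λ a → X.Tran X.s₀ a (σ u)
  map-initial-step {e} {u} z with total e
  ... | a , ηe≡a = a , subst (λ s → X.Tran s a (σ u)) σ-init (tran-def z ηe≡a)

mainTheorem1 : {L : Set} (X Y : LabelledAS L) → PomBisimilar X Y →
    ∀ (a₁ : AsyncSystem.E (LabelledAS.sys X)) (t : AsyncSystem.S (LabelledAS.sys X)) →
    AsyncSystem.Tran (LabelledAS.sys X) (AsyncSystem.s₀ (LabelledAS.sys X)) a₁ t →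
    Σ (AsyncSystem.E (LabelledAS.sys Y)) λ a₁′ →
    Σ (AsyncSystem.S (LabelledAS.sys Y)) λ t′ →
      AsyncSystem.Tran (LabelledAS.sys Y) (AsyncSystem.s₀ (LabelledAS.sys Y)) a₁′ t′ ×
      PomBisimilar (restartL X t) (restartL Y t′)
mainTheorem1 X Y (Z , f , g) a₁ t x with lift-initial-step f x
... | e , u , z , σu≡t with map-initial-step g z
... | a₁′ , y =
  a₁′ , _ , y ,
  restartL Z u , PomOpen-restart f reach σu≡t , PomOpen-restart g reach refl
  where reach = Reachable-step (LabelledAS.sys Z) z
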